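{- Let $G$ be a graph whose node set is finite of cardinality $n$, let $x,y:\mathsf{N}_G$, and let $w:\mathsf{W}_G(x,y)$ be a quasi-simple walk of length $m$. Then $m\le n$.
   Context: Setting: homotopy type theory. A type $X$ is finite of cardinality $n$ if $\|X\simeq⟦n⟧\|$, $⟦n⟧$ the $n$-element type. A graph $G$: a set $\mathsf{N}_G$ of nodes and sets $\mathsf{E}_G(x,y)$ of edges. Walks: inductive family $\mathsf{W}_G(x,y)$ with $\langle x\rangle:\mathsf{W}_G(x,x)$ and $e\odot w:\mathsf{W}_G(x,z)$ for $e:\mathsf{E}_G(x,y)$, $w:\mathsf{W}_G(y,z)$; $\mathsf{length}$ counts edges. For a node $u$: $u\in\langle z\rangle:\equiv\mathbb{0}$, $u\in(e\odot w):\equiv(u=\mathsf{source}(e))+(u\in w)$. $w$ is quasi-simple if $\prod_{u}\mathsf{isProp}(u\in w)$. -}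

module Defs where

open import Level using (Level; _⊔_; Lift) renaming (suc to lsuc)
open import Data.Nat using (ℕ; zero; suc)
open import Data.Fin using (Fin)
open import Data.Empty using (⊥)
open import Data.Sum using (_⊎_)
open import Function.Bundles using (_↔_)
open import Relation.Binary.PropositionalEquality using (_≡_)

isProp : ∀ {a} → Set a → Set a
isProp A = (x y : A) → x ≡ y

isSet : ∀ {a} → Set a → Set a
isSet A = (x y : A) → isProp (x ≡ y)

-- Propositional truncation, impredicative (Church) encoding at the level of A
∥_∥ : ∀ {a} → Set a → Set (lsuc a)
∥_∥ {a} A = (P : Set a) → isProp P → (A → P) → P

-- ⟦n⟧ is Fin n; X is finite of cardinality n iff ∥ X ≃ ⟦n⟧ ∥
isFiniteOfCard : ∀ {a} → Set a → ℕ → Set (lsuc a)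
isFiniteOfCard X n = ∥ X ↔ Fin n ∥

record Graph (ℓn ℓe : Level) : Set (lsuc (ℓn ⊔ ℓe)) where
  field
    Node      : Set ℓn
    Edge      : Node → Node → Set ℓe
    nodeIsSet : isSet Node
    edgeIsSet : (x y : Node) → isSet (Edge x y)
open Graph public

module _ {ℓn ℓe} (G : Graph ℓn ℓe) where
  data Walk : Node G → Node G → Set (ℓn ⊔ ℓe) where
    ⟨_⟩ : (x : Node G) → Walk x x
    _⊙_ : ∀ {x y z} → Edge G x y → Walk y z → Walk x z

module _ {ℓn ℓe} {G : Graph ℓn ℓe} where
  length : ∀ {x y} → Walk G x y → ℕ
  length ⟨ _ ⟩ = zero
  length (e ⊙ w) = suc (length w)

  _∈_ : ∀ {x y} → Node G → Walk G x y → Set ℓn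
  u ∈ ⟨ _ ⟩ = Lift ℓn ⊥
  u ∈ (_⊙_ {x} e w) = (u ≡ x) ⊎ (u ∈ w)

  isQuasiSimple : ∀ {x y} → Walk G x y → Set ℓn
  isQuasiSimple w = (u : Node G) → isProp (u ∈ w)

{-# OPTIONS --safe #-}
-- Listing the sources of the edges of a walk of length m gives a map
-- Fin m → Node G, and quasi-simplicity says exactly that no node occurs
-- twice, so this map is injective.  Composed with an equivalence
-- Node G ≃ Fin n it yields an injection Fin m → Fin n, whence m ≤ n; the
-- truncation may be eliminated because m ≤ n is a proposition.
module Submission where

open import Defs
open import Level using (Lift; lift; lower)
open import Data.Nat using (ℕ; _≤_)
open import Data.Nat.Properties using (≤-irrelevant)
open import Data.Fin using (Fin; zero; suc)
open import Data.Fin.Properties using (injective⇒≤)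
open import Data.Sum using (inj₁; inj₂)
open import Data.Sum.Properties using (inj₂-injective)
open import Function.Bundles using (Injection)
open import Function.Properties.Inverse using (↔⇒↣)
open import Function.Definitions using (Injective)
open import Function.Construct.Composition using (injective)
open import Relation.Binary.PropositionalEquality using (_≡_; refl; sym; cong; subst)

∥∥-rec : ∀ {a} {A : Set a} {B : Set a} → isProp B → (A → B) → ∥ A ∥ → B
∥∥-rec {B = B} B-prop f ∣a∣ = ∣a∣ B B-prop f

isProp-Lift : ∀ {a b} {B : Set b} → isProp B → isProp (Lift a B)
isProp-Lift B-prop p q = cong lift (B-prop (lower p) (lower q))

injective⇒≤-card : ∀ {a} {A : Set a} {m n : ℕ} → isFiniteOfCard A n →
  (f : Fin m → A) → Injective _≡_ _≡_ f → m ≤ n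
injective⇒≤-card A≃Fin f f-inj = lower (∥∥-rec
  (isProp-Lift ≤-irrelevant)
  (λ A↔Fin → lift (injective⇒≤ (injective _≡_ _≡_ _≡_ f-inj (Injection.injective (↔⇒↣ A↔Fin)))))
  A≃Fin)

module _ {ℓn ℓe} {G : Graph ℓn ℓe} where

  source : ∀ {x y} (w : Walk G x y) → Fin (length w) → Node G
  source (_⊙_ {x} _ _) zero    = x
  source (_ ⊙ w)       (suc i) = source w i

  source-∈ : ∀ {x y} (w : Walk G x y) (i : Fin (length w)) → source w i ∈ w
  source-∈ (_ ⊙ _) zero    = inj₁ refl
  source-∈ (_ ⊙ w) (suc i) = inj₂ (source-∈ w i)

  isQuasiSimple-tail : ∀ {x y z} (e : Edge G x y) (w : Walk G y z) →
    isQuasiSimple (e ⊙ w) → isQuasiSimple w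
  isQuasiSimple-tail e w qs u p q = inj₂-injective (qs u (inj₂ p) (inj₂ q))

  source-injective : ∀ {x y} (w : Walk G x y) → isQuasiSimple w →
    Injective _≡_ _≡_ (source w)
  source-injective (_ ⊙ _) qs {zero}  {zero}  _  = refl
  source-injective (_⊙_ {x} _ w) qs {zero} {suc j} eq
    with () ← qs x (inj₁ refl) (inj₂ (subst (_∈ w) (sym eq) (source-∈ w j)))
  source-injective (_⊙_ {x} _ w) qs {suc i} {zero} eq
    with () ← qs x (inj₁ refl) (inj₂ (subst (_∈ w) eq (source-∈ w i)))
  source-injective (e ⊙ w) qs {suc i} {suc j} eq =
    cong suc (source-injective w (isQuasiSimple-tail e w qs) eq)

lemma4p21 : ∀ {ℓn ℓe} (G : Graph ℓn ℓe) (n : ℕ) → isFiniteOfCard (Node G) n →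
    (x y : Node G) (w : Walk G x y) → isQuasiSimple w → length w ≤ n
lemma4p21 G n fin x y w qs = injective⇒≤-card fin (source w) (source-injective w qs)
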